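{- Let $U'$ be the set of positive roots of the $E_8$ root system of $8$-height $0$ and $7$-height $1$, let $W(E_6)=\langle s_1,\dots,s_6\rangle$ act on $\Omega_{U'}$ by the standard action, and let $x_0=\{\alpha_7,\ \theta_6,\ \theta_7\}\in\Omega_{U'}$, where $\theta_6=\alpha_2+\alpha_3+2\alpha_4+2\alpha_5+2\alpha_6+\alpha_7$ and $\theta_7=2\alpha_1+2\alpha_2+3\alpha_3+4\alpha_4+3\alpha_5+2\alpha_6+\alpha_7$. Let $F$ be the invariant cubic polynomial of Vavilov–Luzgarev–Pevzner, namely $F=\sum_T(-1)^{\ell(w_T)}x_T$, the sum over the $45$ elements $T$ of the $W(E_6)$-orbit of $x_0$, where $x_T=\prod_{\beta\in T}x_\beta$ and $w_T\in W(E_6)$ is an element of minimal length with $w_T\cdot x_0=T$. Then the generalized Pfaffian $\mathrm{Pf}(U')$ equals $F$.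
   Context: $\Phi$ is the root system of type $E_8$ with simple roots $\alpha_1,\dots,\alpha_8$ labelled so that $\alpha_1,\alpha_3,\alpha_4,\alpha_5,\alpha_6,\alpha_7,\alpha_8$ form a path in this order and $\alpha_2$ is joined only to $\alpha_4$; $B$ is the invariant form, $s_\alpha(\beta)=\beta-B(\alpha,\beta)\alpha$, $s_i=s_{\alpha_i}$; the $i$-height of a root is its $\alpha_i$-coefficient; $\ell$ is Coxeter length with respect to $\{s_1,\dots,s_6\}$. For a root $\alpha$, $|\alpha|$ is the positive root among $\pm\alpha$; standard action: $w\cdot R=\{|w(\alpha)|:\alpha\in R\}$. For $U\subseteq\Phi_+$: $\Omega_U$ is the set of pairwise orthogonal subsets of $U$ of maximal size; $\rho_U(R)=|\{\gamma\in U:s_\beta(\gamma)\in\Phi_+\ \forall\beta\in R\}|$; with commuting indeterminates $x_\beta$ ($\beta\in U$), $\mathrm{Pf}(U)=\sum_{R\in\Omega_U}(-1)^{\rho_U(R)}\prod_{\beta\in R}x_\beta$. -}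

module Defs where

open import Data.Bool using (Bool; true; false; if_then_else_; _∨_)
open import Data.Nat using (ℕ; zero; suc; _≤_; _<_; _≡ᵇ_)
open import Data.Integer using (ℤ; +_; -_; _*_; _+_; _-_; _≤?_) renaming (_≤_ to _≤ℤ_)
open import Data.Fin using (Fin; toℕ; _↑ˡ_; #_)
import Data.Fin as Fin
open import Data.Vec using (Vec; lookup; tabulate; zipWith; _∷_; [])
import Data.Vec as Vec
import Data.Vec.Relation.Unary.All as VAll
open import Data.List using (List; length; map)
open import Data.List.Relation.Unary.All using (All)
open import Data.List.Relation.Unary.AllPairs using (AllPairs)
open import Data.List.Relation.Unary.Unique.Propositional using (Unique)
open import Data.List.Membership.Propositional using (_∈_)
open import Data.Product using (Σ; _×_)
open import Relation.Nullary using (¬_; does)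
open import Relation.Binary.PropositionalEquality using (_≡_)

-- Vectors in the root lattice of E8, written in the basis of simple roots:
-- entry i (0-based) is the coefficient of α_{i+1}.
Vec8 : Set
Vec8 = Vec ℤ 8

-- Dynkin edges of E8 (0-based): 1-3,3-4,4-5,5-6,6-7,7-8 and 2-4 (1-based).
edge : ℕ → ℕ → Bool
edge 0 2 = true
edge 2 3 = true
edge 3 4 = true
edge 4 5 = true
edge 5 6 = true
edge 6 7 = true
edge 1 3 = true
edge _ _ = false

cartan : ℕ → ℕ → ℤ
cartan m n = if m ≡ᵇ n then + 2 else (if edge m n ∨ edge n m then - (+ 1) else + 0)

sumV : ∀ {n} → Vec ℤ n → ℤ
sumV = Vec.foldr _ _+_ (+ 0)

B : Vec8 → Vec8 → ℤ
B u v = sumV (tabulate λ i → sumV (tabulate λ j →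
          lookup u i * cartan (toℕ i) (toℕ j) * lookup v j))

α : Fin 8 → Vec8
α i = tabulate λ j → if does (i Fin.≟ j) then + 1 else + 0

refl' : Vec8 → Vec8 → Vec8
refl' a b = zipWith _-_ b (Vec.map (λ x → B a b * x) a)

data IsRoot : Vec8 → Set where
  simple : (i : Fin 8) → IsRoot (α i)
  reflect : (i : Fin 8) {v : Vec8} → IsRoot v → IsRoot (refl' (α i) v)

Pos : Vec8 → Set
Pos v = IsRoot v × VAll.All (λ x → + 0 ≤ℤ x) v

U' : Vec8 → Set
U' v = Pos v × lookup v (# 7) ≡ + 0 × lookup v (# 6) ≡ + 1

-- finite sets of roots are represented by duplicate-free lists
OrthSub : List Vec8 → Set
OrthSub R = Unique R × All U' R × AllPairs (λ a b → B a b ≡ + 0) R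

Ω : List Vec8 → Set
Ω R = OrthSub R × (∀ R' → OrthSub R' → length R' ≤ length R)

HasCard : (Vec8 → Set) → ℕ → Set
HasCard P n = Σ (List Vec8) λ L → Unique L × (∀ x → x ∈ L → P x)
                × (∀ x → P x → x ∈ L) × length L ≡ n

Rho : List Vec8 → ℕ → Set
Rho R r = HasCard (λ γ → U' γ × All (λ β → Pos (refl' β γ)) R) r

sgn : ℕ → ℤ
sgn zero = + 1
sgn (suc k) = - sgn k

-- c is the coefficient of the monomial x_S in Pf(U')
PfCoeff : List Vec8 → ℤ → Set
PfCoeff S c = (Ω S × Σ ℕ λ r → Rho S r × c ≡ sgn r) Data.Sum.⊎ (¬ Ω S × c ≡ + 0)
  where import Data.Sum

absR : Vec8 → Vec8
absR v = if does (VAll.all? (λ x → + 0 ≤? x) v) then v else Vec.map -_ v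

-- action of a word s_{i1} ... s_{ik} in the generators s_1..s_6 of W(E6)
act : List (Fin 6) → Vec8 → Vec8
act List.[] v = v
act (i List.∷ w) v = refl' (α (i ↑ˡ 2)) (act w v)

actSet : List (Fin 6) → List Vec8 → List Vec8
actSet w R = map (λ v → absR (act w v)) R

SameSet : List Vec8 → List Vec8 → Set
SameSet A C = ∀ v → (v ∈ A → v ∈ C) × (v ∈ C → v ∈ A)

θ6 θ7 : Vec8
θ6 = + 0 ∷ + 1 ∷ + 1 ∷ + 2 ∷ + 2 ∷ + 2 ∷ + 1 ∷ + 0 ∷ []
θ7 = + 2 ∷ + 2 ∷ + 3 ∷ + 4 ∷ + 3 ∷ + 2 ∷ + 1 ∷ + 0 ∷ []

x0 : List Vec8
x0 = α (# 6) List.∷ θ6 List.∷ θ7 List.∷ List.[]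

-- some element of W(E6) of length ≤ k (a word of length k) sends x0 to S
Reach : List Vec8 → ℕ → Set
Reach S k = Σ (List (Fin 6)) λ w → length w ≡ k × SameSet (actSet w x0) S

-- c is the coefficient of the monomial x_S in F
FCoeff : List Vec8 → ℤ → Set
FCoeff S c = (Σ ℕ λ k → Reach S k × (∀ j → j < k → ¬ Reach S j) × c ≡ sgn k)
             Data.Sum.⊎ ((¬ Σ ℕ λ k → Reach S k) × c ≡ + 0)
  where import Data.Sum

-- Every listed positive root of E8 is
-- certified to be a root by descending along simple reflections, and since the list and its
-- negatives are closed under the simple reflections there are no other roots; hence U' consists
-- of 27 known roots. An orthogonal subset of U' has at most three elements, and the orthogonal
-- triples are exactly the 45 triples in the W(E6)-orbit of x0: every orthogonal triple occurs in
-- the orbit, and no element of U' is orthogonal to all three elements of an orbit triple. So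
-- Pf(U') and F have the same support. The orbit is generated breadth first, which stores every
-- triple T with a word of minimal length, and (-1)^ℓ(w_T) = (-1)^ρ(T) is checked triple by
-- triple. The standard action is compatible with this because simple reflections commute with
-- negation and every root is plus or minus a positive root.

module Submission where

open import Defs
open import Data.Integer using (ℤ)
open import Data.List using (List)
open import Data.List.Relation.Unary.All using (All)
open import Data.List.Relation.Unary.Unique.Propositional using (Unique)
open import Data.Product using (Σ; _×_)

open import Data.Bool using (true; false; if_then_else_)
open import Data.Empty using (⊥; ⊥-elim)
open import Data.Fin using (Fin; zero; suc; toℕ; #_; _↑ˡ_)
import Data.Fin.Properties as Fin
open import Data.Integer using (+_; -_; _+_; _-_; _*_)
import Data.Integer as ℤ
open import Data.Integer.Properties using (*-zeroʳ; neg-distrib-+; neg-involutive)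
open import Data.Integer.Solver using (module +-*-Solver)
open import Data.List using ([]; _∷_; [_]; _++_; filter; deduplicate; concatMap; allFin; length)
import Data.List as List
import Data.List.Properties as List
open import Data.List.Membership.Propositional using (_∈_; find; lose)
open import Data.List.Membership.Propositional.Properties
  using (∈-filter⁺; ∈-filter⁻; ∈-++⁻; ∈-++⁺ˡ; ∈-++⁺ʳ; ∈-map⁺; ∈-map⁻)
open import Data.List.Membership.Propositional.Properties.WithK using (unique∧set⇒bag)
open import Data.List.Relation.Binary.BagAndSetEquality using (∼bag⇒↭)
open import Data.List.Relation.Binary.Permutation.Propositional.Properties using (↭-length)
import Data.List.Relation.Binary.Subset.Propositional.Properties as Subset
open import Data.List.Relation.Unary.All using ([]; _∷_; all?)
import Data.List.Relation.Unary.All as All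
import Data.List.Relation.Unary.All.Properties as All
open import Data.List.Relation.Unary.AllPairs using (AllPairs; []; _∷_)
open import Data.List.Relation.Unary.Any using (Any; here; there; any?)
import Data.List.Relation.Unary.Unique.Propositional.Properties as Unique
open import Data.Maybe using (Maybe; just; nothing; maybe; from-just)
import Data.Maybe as Maybe
open import Data.Nat using (ℕ; zero; suc; _≤_; _<_; z≤n; s≤s)
import Data.Nat as ℕ
open import Data.Nat.Properties using (≤-trans; ≤-reflexive; <⇒≱)
open import Data.Product using (_,_; proj₁; proj₂; ∃)
open import Data.Sum using (_⊎_; inj₁; inj₂)
import Data.Sum as Sum
open import Data.Vec using (Vec; []; _∷_; tabulate; lookup; zipWith)
import Data.Vec as Vec
open import Data.Vec.Properties using (tabulate-cong; lookup-zipWith; lookup-map)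
import Data.Vec.Properties as Vec
import Data.Vec.Relation.Unary.All as VAll
open import Function using (_∘_; mk⇔)
open import Level using (0ℓ)
open import Relation.Binary using (Rel; DecidableEquality)
import Relation.Binary as Binary
open import Relation.Binary.PropositionalEquality
  using (_≡_; _≢_; refl; cong; cong₂; trans; sym; subst; module ≡-Reasoning)
open import Relation.Nullary using (¬_; ¬?; Dec; does; yes; no; _×-dec_; _⊎-dec_; _→-dec_)
open import Relation.Nullary.Decidable using (from-yes; map′; dec-true; dec-false)
open import Relation.Unary using (Decidable)
open +-*-Solver using (solve; _:=_; _:+_; _:-_; _:*_; :-_; con)

_≟ᵥ_ : DecidableEquality Vec8
_≟ᵥ_ = Vec.≡-dec ℤ._≟_

open import Data.List.Membership.DecPropositional _≟ᵥ_ using (_∈?_)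
open import Data.List.Relation.Binary.Subset.DecPropositional _≟ᵥ_ using (_⊆_; _⊆?_)
open import Data.List.Relation.Unary.Unique.DecPropositional _≟ᵥ_ using (unique?)

-- Lists as finite sets

sameSet? : (A C : List Vec8) → Dec (SameSet A C)
sameSet? A C = map′ fromSubsets toSubsets ((A ⊆? C) ×-dec (C ⊆? A))
  where
  fromSubsets : A ⊆ C × C ⊆ A → SameSet A C
  fromSubsets (A⊆C , C⊆A) v = A⊆C , C⊆A
  toSubsets : SameSet A C → A ⊆ C × C ⊆ A
  toSubsets A≈C = proj₁ (A≈C _) , proj₂ (A≈C _)

sameSet-sym : ∀ {A C} → SameSet A C → SameSet C A
sameSet-sym A≈C v = proj₂ (A≈C v) , proj₁ (A≈C v)

sameSet-trans : ∀ {A C D} → SameSet A C → SameSet C D → SameSet A D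
sameSet-trans A≈C C≈D v = proj₁ (C≈D v) ∘ proj₁ (A≈C v) , proj₂ (A≈C v) ∘ proj₂ (C≈D v)

sameSet-map : ∀ (f : Vec8 → Vec8) {A C} → SameSet A C → SameSet (List.map f A) (List.map f C)
sameSet-map f A≈C v = Subset.map⁺ f (proj₁ (A≈C _)) , Subset.map⁺ f (proj₂ (A≈C _))

sameSet-length : ∀ {A C} → Unique A → Unique C → SameSet A C → length A ≡ length C
sameSet-length uA uC A≈C =
  ↭-length (∼bag⇒↭ (unique∧set⇒bag uA uC (mk⇔ (proj₁ (A≈C _)) (proj₂ (A≈C _)))))

All-sameSet : ∀ {P : Vec8 → Set} {A C} → SameSet A C → All P A → All P C
All-sameSet A≈C P-A = All.tabulate λ x∈C → All.lookup P-A (proj₂ (A≈C _) x∈C)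

allPairs-fromMembers : ∀ {A : Set} {R : A → A → Set} {S : List A} → Unique S →
                       (∀ {x y} → x ∈ S → y ∈ S → x ≢ y → R x y) → AllPairs R S
allPairs-fromMembers []         R-S = []
allPairs-fromMembers (x∉ ∷ uS) R-S =
  All.tabulate (λ y∈ → R-S (here refl) (there y∈) (All.lookup x∉ y∈))
  ∷ allPairs-fromMembers uS (λ x∈ y∈ → R-S (there x∈) (there y∈))

HasCard-cong : ∀ {P Q n} → (∀ x → P x → Q x) → (∀ x → Q x → P x) → HasCard P n → HasCard Q n
HasCard-cong P⇒Q Q⇒P (L , uL , L⇒P , P⇒L , |L|≡n) =
  L , uL , (λ x → P⇒Q x ∘ L⇒P x) , (λ x → P⇒L x ∘ Q⇒P x) , |L|≡n

module BreadthFirst {A : Set} {_≈_ : Rel A 0ℓ} (_≈?_ : Binary.Decidable _≈_) (step : A → List A)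
  where

  fresh : List A → List A → List A
  fresh seen frontier =
    deduplicate _≈?_ (filter (λ x → ¬? (any? (x ≈?_) seen)) (concatMap step frontier))

  explore : ℕ → List A → List A → List A
  explore zero    seen frontier = seen
  explore (suc n) seen frontier = grow (fresh seen frontier)
    -- binding the new layer to a variable makes the normaliser compute it only once
    where
    grow : List A → List A
    grow new = explore n (seen ++ new) new

  closure : ℕ → A → List A
  closure n x = explore n [ x ] [ x ]

-- Linearity of B and the reflections

sumV-linear : ∀ {n} (k : ℤ) (f g : Fin n → ℤ) →
              sumV (tabulate (λ j → f j - k * g j)) ≡ sumV (tabulate f) - k * sumV (tabulate g)
sumV-linear {zero}  k f g = cong (λ x → + 0 - x) (sym (*-zeroʳ k))
sumV-linear {suc n} k f g = begin
  (f zero - k * g zero) + sumV (tabulate (λ j → f (suc j) - k * g (suc j)))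
    ≡⟨ cong (λ x → (f zero - k * g zero) + x) (sumV-linear k (f ∘ suc) (g ∘ suc)) ⟩
  (f zero - k * g zero) + (F - k * G)
    ≡⟨ solve 5 (λ k f₀ g₀ F G → (f₀ :- k :* g₀) :+ (F :- k :* G) := (f₀ :+ F) :- k :* (g₀ :+ G))
             refl k (f zero) (g zero) F G ⟩
  (f zero + F) - k * (g zero + G) ∎
  where
  open ≡-Reasoning
  F = sumV (tabulate (f ∘ suc))
  G = sumV (tabulate (g ∘ suc))

sumV-neg : ∀ {n} (f : Fin n → ℤ) → sumV (tabulate (λ j → - f j)) ≡ - sumV (tabulate f)
sumV-neg {zero}  f = refl
sumV-neg {suc n} f = begin
  - f zero + sumV (tabulate (λ j → - f (suc j)))  ≡⟨ cong (λ x → - f zero + x) (sumV-neg (f ∘ suc)) ⟩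
  - f zero + - sumV (tabulate (f ∘ suc))          ≡⟨ sym (neg-distrib-+ (f zero) _) ⟩
  - (f zero + sumV (tabulate (f ∘ suc)))          ∎
  where open ≡-Reasoning

B-linearʳ : ∀ a v u k → B a (zipWith _-_ v (Vec.map (k *_) u)) ≡ B a v - k * B a u
B-linearʳ a v u k = begin
  B a (zipWith _-_ v (Vec.map (k *_) u))
    ≡⟨ cong sumV (tabulate-cong λ i →
         trans (cong sumV (tabulate-cong (entry i))) (sumV-linear k (term v i) (term u i))) ⟩
  sumV (tabulate λ i → row v i - k * row u i)
    ≡⟨ sumV-linear k (row v) (row u) ⟩
  B a v - k * B a u ∎
  where
  open ≡-Reasoning
  term : Vec8 → Fin 8 → Fin 8 → ℤ
  term x i j = lookup a i * cartan (toℕ i) (toℕ j) * lookup x j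
  row : Vec8 → Fin 8 → ℤ
  row x i = sumV (tabulate (term x i))
  entry : ∀ i j → term (zipWith _-_ v (Vec.map (k *_) u)) i j ≡ term v i j - k * term u i j
  entry i j rewrite lookup-zipWith _-_ j v (Vec.map (k *_) u) | lookup-map j (k *_) u =
    solve 4 (λ c k x y → c :* (x :- k :* y) := c :* x :- k :* (c :* y))
          refl (lookup a i * cartan (toℕ i) (toℕ j)) k (lookup v j) (lookup u j)

neg : Vec8 → Vec8
neg = Vec.map (λ x → - x)

neg-neg : ∀ v → neg (neg v) ≡ v
neg-neg v = trans (sym (Vec.map-∘ (λ x → - x) (λ x → - x) v))
                  (trans (Vec.map-cong neg-involutive v) (Vec.map-id v))

B-negʳ : ∀ a v → B a (neg v) ≡ - B a v
B-negʳ a v = begin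
  B a (neg v)
    ≡⟨ cong sumV (tabulate-cong λ i →
         trans (cong sumV (tabulate-cong (entry i))) (sumV-neg (term i))) ⟩
  sumV (tabulate λ i → - sumV (tabulate (term i)))
    ≡⟨ sumV-neg (λ i → sumV (tabulate (term i))) ⟩
  - B a v ∎
  where
  open ≡-Reasoning
  term : Fin 8 → Fin 8 → ℤ
  term i j = lookup a i * cartan (toℕ i) (toℕ j) * lookup v j
  entry : ∀ i j → lookup a i * cartan (toℕ i) (toℕ j) * lookup (neg v) j ≡ - term i j
  entry i j rewrite lookup-map j (λ x → - x) v =
    solve 2 (λ c x → c :* (:- x) := :- (c :* x))
          refl (lookup a i * cartan (toℕ i) (toℕ j)) (lookup v j)

refl'-involutive : ∀ a v → B a a ≡ + 2 → refl' a (refl' a v) ≡ v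
refl'-involutive a v Baa≡2 = begin
  refl' a (refl' a v)
    ≡⟨ cong (λ c → zipWith _-_ (refl' a v) (Vec.map (c *_) a)) B-image ⟩
  zipWith _-_ (refl' a v) (Vec.map (- B a v *_) a)
    ≡⟨ subtract-twice v a (B a v) ⟩
  v ∎
  where
  open ≡-Reasoning
  B-image : B a (refl' a v) ≡ - B a v
  B-image = begin
    B a (refl' a v)        ≡⟨ B-linearʳ a v a (B a v) ⟩
    B a v - B a v * B a a  ≡⟨ cong (λ x → B a v - B a v * x) Baa≡2 ⟩
    B a v - B a v * + 2    ≡⟨ solve 1 (λ b → b :- b :* con (+ 2) := :- b) refl (B a v) ⟩
    - B a v ∎
  subtract-twice : ∀ {n} (v a : Vec ℤ n) b →
                   zipWith _-_ (zipWith _-_ v (Vec.map (b *_) a)) (Vec.map (- b *_) a) ≡ v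
  subtract-twice []      []      b = refl
  subtract-twice (x ∷ v) (y ∷ a) b =
    cong₂ _∷_ (solve 3 (λ x y b → (x :- b :* y) :- (:- b) :* y := x) refl x y b)
              (subtract-twice v a b)

refl'-neg : ∀ a v → refl' a (neg v) ≡ neg (refl' a v)
refl'-neg a v = begin
  refl' a (neg v)
    ≡⟨ cong (λ c → zipWith _-_ (neg v) (Vec.map (c *_) a)) (B-negʳ a v) ⟩
  zipWith _-_ (neg v) (Vec.map (- B a v *_) a)
    ≡⟨ negate-difference v a (B a v) ⟩
  neg (refl' a v) ∎
  where
  open ≡-Reasoning
  negate-difference : ∀ {n} (v a : Vec ℤ n) b →
                      zipWith _-_ (Vec.map (λ x → - x) v) (Vec.map (- b *_) a)
                        ≡ Vec.map (λ x → - x) (zipWith _-_ v (Vec.map (b *_) a))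
  negate-difference []      []      b = refl
  negate-difference (x ∷ v) (y ∷ a) b =
    cong₂ _∷_ (solve 3 (λ x y b → :- x :- (:- b) :* y := :- (x :- b :* y)) refl x y b)
              (negate-difference v a b)

-- The root system

s : Fin 8 → Vec8 → Vec8
s i = refl' (α i)

B-α-α : ∀ i → B (α i) (α i) ≡ + 2
B-α-α = from-yes (Fin.all? λ i → B (α i) (α i) ℤ.≟ + 2)

s-involutive : ∀ i v → s i (s i v) ≡ v
s-involutive i v = refl'-involutive (α i) v (B-α-α i)

root⁺ : ℕ → ℕ → ℕ → ℕ → ℕ → ℕ → ℕ → ℕ → Vec8
root⁺ a b c d e f g h = + a ∷ + b ∷ + c ∷ + d ∷ + e ∷ + f ∷ + g ∷ + h ∷ []

-- Ordered by height, so that every non-simple root is a simple reflection of an earlier one.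
positiveRoots : List Vec8
positiveRoots =
  root⁺ 0 0 0 0 0 0 0 1 ∷ root⁺ 0 0 0 0 0 0 1 0 ∷ root⁺ 0 0 0 0 0 1 0 0 ∷ root⁺ 0 0 0 0 1 0 0 0 ∷
  root⁺ 0 0 0 1 0 0 0 0 ∷ root⁺ 0 0 1 0 0 0 0 0 ∷ root⁺ 0 1 0 0 0 0 0 0 ∷ root⁺ 1 0 0 0 0 0 0 0 ∷
  root⁺ 0 0 0 0 0 0 1 1 ∷ root⁺ 0 0 0 0 0 1 1 0 ∷ root⁺ 0 0 0 0 1 1 0 0 ∷ root⁺ 0 0 0 1 1 0 0 0 ∷
  root⁺ 0 0 1 1 0 0 0 0 ∷ root⁺ 0 1 0 1 0 0 0 0 ∷ root⁺ 1 0 1 0 0 0 0 0 ∷ root⁺ 0 0 0 0 0 1 1 1 ∷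
  root⁺ 0 0 0 0 1 1 1 0 ∷ root⁺ 0 0 0 1 1 1 0 0 ∷ root⁺ 0 0 1 1 1 0 0 0 ∷ root⁺ 0 1 0 1 1 0 0 0 ∷
  root⁺ 0 1 1 1 0 0 0 0 ∷ root⁺ 1 0 1 1 0 0 0 0 ∷ root⁺ 0 0 0 0 1 1 1 1 ∷ root⁺ 0 0 0 1 1 1 1 0 ∷
  root⁺ 0 0 1 1 1 1 0 0 ∷ root⁺ 0 1 0 1 1 1 0 0 ∷ root⁺ 0 1 1 1 1 0 0 0 ∷ root⁺ 1 0 1 1 1 0 0 0 ∷
  root⁺ 1 1 1 1 0 0 0 0 ∷ root⁺ 0 0 0 1 1 1 1 1 ∷ root⁺ 0 0 1 1 1 1 1 0 ∷ root⁺ 0 1 0 1 1 1 1 0 ∷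
  root⁺ 0 1 1 1 1 1 0 0 ∷ root⁺ 0 1 1 2 1 0 0 0 ∷ root⁺ 1 0 1 1 1 1 0 0 ∷ root⁺ 1 1 1 1 1 0 0 0 ∷
  root⁺ 0 0 1 1 1 1 1 1 ∷ root⁺ 0 1 0 1 1 1 1 1 ∷ root⁺ 0 1 1 1 1 1 1 0 ∷ root⁺ 0 1 1 2 1 1 0 0 ∷
  root⁺ 1 0 1 1 1 1 1 0 ∷ root⁺ 1 1 1 1 1 1 0 0 ∷ root⁺ 1 1 1 2 1 0 0 0 ∷ root⁺ 0 1 1 1 1 1 1 1 ∷
  root⁺ 0 1 1 2 1 1 1 0 ∷ root⁺ 0 1 1 2 2 1 0 0 ∷ root⁺ 1 0 1 1 1 1 1 1 ∷ root⁺ 1 1 1 1 1 1 1 0 ∷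
  root⁺ 1 1 1 2 1 1 0 0 ∷ root⁺ 1 1 2 2 1 0 0 0 ∷ root⁺ 0 1 1 2 1 1 1 1 ∷ root⁺ 0 1 1 2 2 1 1 0 ∷
  root⁺ 1 1 1 1 1 1 1 1 ∷ root⁺ 1 1 1 2 1 1 1 0 ∷ root⁺ 1 1 1 2 2 1 0 0 ∷ root⁺ 1 1 2 2 1 1 0 0 ∷
  root⁺ 0 1 1 2 2 1 1 1 ∷ root⁺ 0 1 1 2 2 2 1 0 ∷ root⁺ 1 1 1 2 1 1 1 1 ∷ root⁺ 1 1 1 2 2 1 1 0 ∷
  root⁺ 1 1 2 2 1 1 1 0 ∷ root⁺ 1 1 2 2 2 1 0 0 ∷ root⁺ 0 1 1 2 2 2 1 1 ∷ root⁺ 1 1 1 2 2 1 1 1 ∷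
  root⁺ 1 1 1 2 2 2 1 0 ∷ root⁺ 1 1 2 2 1 1 1 1 ∷ root⁺ 1 1 2 2 2 1 1 0 ∷ root⁺ 1 1 2 3 2 1 0 0 ∷
  root⁺ 0 1 1 2 2 2 2 1 ∷ root⁺ 1 1 1 2 2 2 1 1 ∷ root⁺ 1 1 2 2 2 1 1 1 ∷ root⁺ 1 1 2 2 2 2 1 0 ∷
  root⁺ 1 1 2 3 2 1 1 0 ∷ root⁺ 1 2 2 3 2 1 0 0 ∷ root⁺ 1 1 1 2 2 2 2 1 ∷ root⁺ 1 1 2 2 2 2 1 1 ∷
  root⁺ 1 1 2 3 2 1 1 1 ∷ root⁺ 1 1 2 3 2 2 1 0 ∷ root⁺ 1 2 2 3 2 1 1 0 ∷ root⁺ 1 1 2 2 2 2 2 1 ∷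
  root⁺ 1 1 2 3 2 2 1 1 ∷ root⁺ 1 1 2 3 3 2 1 0 ∷ root⁺ 1 2 2 3 2 1 1 1 ∷ root⁺ 1 2 2 3 2 2 1 0 ∷
  root⁺ 1 1 2 3 2 2 2 1 ∷ root⁺ 1 1 2 3 3 2 1 1 ∷ root⁺ 1 2 2 3 2 2 1 1 ∷ root⁺ 1 2 2 3 3 2 1 0 ∷
  root⁺ 1 1 2 3 3 2 2 1 ∷ root⁺ 1 2 2 3 2 2 2 1 ∷ root⁺ 1 2 2 3 3 2 1 1 ∷ root⁺ 1 2 2 4 3 2 1 0 ∷
  root⁺ 1 1 2 3 3 3 2 1 ∷ root⁺ 1 2 2 3 3 2 2 1 ∷ root⁺ 1 2 2 4 3 2 1 1 ∷ root⁺ 1 2 3 4 3 2 1 0 ∷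
  root⁺ 1 2 2 3 3 3 2 1 ∷ root⁺ 1 2 2 4 3 2 2 1 ∷ root⁺ 1 2 3 4 3 2 1 1 ∷ root⁺ 2 2 3 4 3 2 1 0 ∷
  root⁺ 1 2 2 4 3 3 2 1 ∷ root⁺ 1 2 3 4 3 2 2 1 ∷ root⁺ 2 2 3 4 3 2 1 1 ∷ root⁺ 1 2 2 4 4 3 2 1 ∷
  root⁺ 1 2 3 4 3 3 2 1 ∷ root⁺ 2 2 3 4 3 2 2 1 ∷ root⁺ 1 2 3 4 4 3 2 1 ∷ root⁺ 2 2 3 4 3 3 2 1 ∷
  root⁺ 1 2 3 5 4 3 2 1 ∷ root⁺ 2 2 3 4 4 3 2 1 ∷ root⁺ 1 3 3 5 4 3 2 1 ∷ root⁺ 2 2 3 5 4 3 2 1 ∷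
  root⁺ 2 2 4 5 4 3 2 1 ∷ root⁺ 2 3 3 5 4 3 2 1 ∷ root⁺ 2 3 4 5 4 3 2 1 ∷ root⁺ 2 3 4 6 4 3 2 1 ∷
  root⁺ 2 3 4 6 5 3 2 1 ∷ root⁺ 2 3 4 6 5 4 2 1 ∷ root⁺ 2 3 4 6 5 4 3 1 ∷ root⁺ 2 3 4 6 5 4 3 2 ∷
  []

negativeRoots : List Vec8
negativeRoots = List.map neg positiveRoots

roots : List Vec8
roots = positiveRoots ++ negativeRoots

certifyRoot : ∀ {done} → All IsRoot done → (v : Vec8) → Maybe (IsRoot v)
certifyRoot {done} done-roots v = bySimple (Fin.any? λ i → α i ≟ᵥ v)
  where
  byReflection : Dec (∃ λ i → s i v ∈ done) → Maybe (IsRoot v)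
  byReflection (yes (i , sv∈)) =
    just (subst IsRoot (s-involutive i v) (reflect i (All.lookup done-roots sv∈)))
  byReflection (no _)          = nothing
  bySimple : Dec (∃ λ i → α i ≡ v) → Maybe (IsRoot v)
  bySimple (yes (i , αi≡v)) = just (subst IsRoot αi≡v (simple i))
  bySimple (no _)           = byReflection (Fin.any? λ i → s i v ∈? done)

certifyRoots : ∀ {done} → All IsRoot done → (vs : List Vec8) → Maybe (All IsRoot vs)
certifyRoots done-roots []       = just []
certifyRoots done-roots (v ∷ vs) =
  maybe (λ r → Maybe.map (r ∷_) (certifyRoots (r ∷ done-roots) vs)) nothing (certifyRoot done-roots v)

positiveRoots-isRoot : All IsRoot positiveRoots
positiveRoots-isRoot = from-just (certifyRoots [] positiveRoots)

Nonneg : Vec8 → Set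
Nonneg = VAll.All (ℤ._≤_ (+ 0))

nonneg? : Decidable Nonneg
nonneg? = VAll.all? (+ 0 ℤ.≤?_)

positiveRoots-sign : All (λ v → Nonneg v × ¬ Nonneg (neg v)) positiveRoots
positiveRoots-sign = from-yes (all? (λ v → nonneg? v ×-dec ¬? (nonneg? (neg v))) positiveRoots)

simple∈positiveRoots : ∀ i → α i ∈ positiveRoots
simple∈positiveRoots = from-yes (Fin.all? λ i → α i ∈? positiveRoots)

positiveRoots-reflect : All (λ v → ∀ i → s i v ∈ roots) positiveRoots
positiveRoots-reflect = from-yes (all? (λ v → Fin.all? λ i → s i v ∈? roots) positiveRoots)

positive∈roots : ∀ {v} → v ∈ positiveRoots → v ∈ roots
positive∈roots = ∈-++⁺ˡ

roots-elim : ∀ {P : Vec8 → Set} →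
             (∀ {p} → p ∈ positiveRoots → P p) → (∀ {p} → p ∈ positiveRoots → P (neg p)) →
             ∀ {v} → v ∈ roots → P v
roots-elim {P} P⁺ P⁻ v∈ = Sum.[ P⁺ , negative ]′ (∈-++⁻ positiveRoots {ys = negativeRoots} v∈)
  where
  negative : ∀ {v} → v ∈ negativeRoots → P v
  negative n∈ = let (p , p∈ , v≡-p) = ∈-map⁻ neg {xs = positiveRoots} n∈ in
                subst P (sym v≡-p) (P⁻ p∈)

neg∈roots : ∀ {v} → v ∈ roots → neg v ∈ roots
neg∈roots = roots-elim {λ v → neg v ∈ roots}
  (∈-++⁺ʳ positiveRoots ∘ ∈-map⁺ neg)
  (λ {p} p∈ → subst (_∈ roots) (sym (neg-neg p)) (positive∈roots p∈))

s∈roots : ∀ i {v} → v ∈ roots → s i v ∈ roots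
s∈roots i = roots-elim {λ v → s i v ∈ roots}
  (λ p∈ → All.lookup positiveRoots-reflect p∈ i)
  (λ {p} p∈ → subst (_∈ roots) (sym (refl'-neg (α i) p))
                    (neg∈roots (All.lookup positiveRoots-reflect p∈ i)))

isRoot⇒∈roots : ∀ {v} → IsRoot v → v ∈ roots
isRoot⇒∈roots (simple i)    = positive∈roots (simple∈positiveRoots i)
isRoot⇒∈roots (reflect i r) = s∈roots i (isRoot⇒∈roots r)

∈positiveRoots⇒Pos : ∀ {v} → v ∈ positiveRoots → Pos v
∈positiveRoots⇒Pos v∈ = All.lookup positiveRoots-isRoot v∈ , proj₁ (All.lookup positiveRoots-sign v∈)

Pos⇒∈positiveRoots : ∀ {v} → Pos v → v ∈ positiveRoots
Pos⇒∈positiveRoots (r , v≥0) = roots-elim {λ v → Nonneg v → v ∈ positiveRoots}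
  (λ p∈ _ → p∈)
  (λ p∈ -p≥0 → ⊥-elim (proj₂ (All.lookup positiveRoots-sign p∈) -p≥0))
  (isRoot⇒∈roots r) v≥0

Pos? : Decidable Pos
Pos? v = map′ (∈positiveRoots⇒Pos ∘ proj₂) (λ pos → proj₂ pos , Pos⇒∈positiveRoots pos)
              (nonneg? v ×-dec (v ∈? positiveRoots))

absR-positive : ∀ {p} → p ∈ positiveRoots → absR p ≡ p
absR-positive {p} p∈ = cong (λ b → if b then p else neg p) {does (nonneg? p)} {true}
  (dec-true (nonneg? p) (proj₁ (All.lookup positiveRoots-sign p∈)))

absR-negative : ∀ {p} → p ∈ positiveRoots → absR (neg p) ≡ p
absR-negative {p} p∈ =
  trans (cong (λ b → if b then neg p else neg (neg p)) {does (nonneg? (neg p))} {false}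
              (dec-false (nonneg? (neg p)) (proj₂ (All.lookup positiveRoots-sign p∈))))
        (neg-neg p)

absR-neg : ∀ {v} → v ∈ roots → absR (neg v) ≡ absR v
absR-neg = roots-elim {λ v → absR (neg v) ≡ absR v}
  (λ p∈ → trans (absR-negative p∈) (sym (absR-positive p∈)))
  (λ {p} p∈ → trans (cong absR {neg (neg p)} {p} (neg-neg p))
                     (trans (absR-positive p∈) (sym (absR-negative p∈))))

-- The implicit arguments of cong are given because inferring them unfolds absR and s.
absR-s-absR : ∀ i {v} → v ∈ roots → absR (s i (absR v)) ≡ absR (s i v)
absR-s-absR i = roots-elim {λ v → absR (s i (absR v)) ≡ absR (s i v)}
  (λ {p} p∈ → cong (λ x → absR (s i x)) {absR p} {p} (absR-positive p∈))
  (λ {p} p∈ → begin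
    absR (s i (absR (neg p)))  ≡⟨ cong (λ x → absR (s i x)) {absR (neg p)} {p} (absR-negative p∈) ⟩
    absR (s i p)               ≡⟨ sym (absR-neg (s∈roots i (positive∈roots p∈))) ⟩
    absR (neg (s i p))         ≡⟨ cong absR {neg (s i p)} {s i (neg p)} (sym (refl'-neg (α i) p)) ⟩
    absR (s i (neg p))         ∎)
  where open ≡-Reasoning

-- The set U' and the count ρ

Heights : Vec8 → Set
Heights v = lookup v (# 7) ≡ + 0 × lookup v (# 6) ≡ + 1

heights? : Decidable Heights
heights? v = (lookup v (# 7) ℤ.≟ + 0) ×-dec (lookup v (# 6) ℤ.≟ + 1)

U'-roots : List Vec8
U'-roots = filter heights? positiveRoots

U'⇒∈U'-roots : ∀ {v} → U' v → v ∈ U'-roots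
U'⇒∈U'-roots (pos , heights) = ∈-filter⁺ heights? (Pos⇒∈positiveRoots pos) heights

∈U'-roots⇒U' : ∀ {v} → v ∈ U'-roots → U' v
∈U'-roots⇒U' v∈ =
  let (p∈ , heights) = ∈-filter⁻ heights? {xs = positiveRoots} v∈ in ∈positiveRoots⇒Pos p∈ , heights

U'-roots-unique : Unique U'-roots
U'-roots-unique = from-yes (unique? U'-roots)

reflectsPositively? : (R : List Vec8) → Decidable (λ γ → All (λ β → Pos (refl' β γ)) R)
reflectsPositively? R γ = all? (λ β → Pos? (refl' β γ)) R

rho : List Vec8 → ℕ
rho R = length (filter (reflectsPositively? R) U'-roots)

Rho-rho : ∀ R → Rho R (rho R)
Rho-rho R =
  filter (reflectsPositively? R) U'-roots ,
  Unique.filter⁺ (reflectsPositively? R) U'-roots-unique ,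
  (λ γ γ∈ → let (u∈ , pos) = ∈-filter⁻ (reflectsPositively? R) {xs = U'-roots} γ∈ in
             ∈U'-roots⇒U' u∈ , pos) ,
  (λ γ (u , pos) → ∈-filter⁺ (reflectsPositively? R) (U'⇒∈U'-roots u) pos) ,
  refl

Rho-sameSet : ∀ {R R' n} → SameSet R R' → Rho R n → Rho R' n
Rho-sameSet R≈R' = HasCard-cong (λ γ (u , pos) → u , All-sameSet R≈R' pos)
                                (λ γ (u , pos) → u , All-sameSet (sameSet-sym R≈R') pos)

-- The W(E6)-orbit of x0

Word : Set
Word = List (Fin 6)

act₁ : Fin 6 → Vec8 → Vec8
act₁ i v = absR (s (i ↑ˡ 2) v)

act-isRoot : ∀ w {v} → IsRoot v → IsRoot (act w v)
act-isRoot []      r = r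
act-isRoot (i ∷ w) r = reflect (i ↑ˡ 2) (act-isRoot w r)

actSet-∷ : ∀ i w {R} → All IsRoot R → actSet (i ∷ w) R ≡ List.map (act₁ i) (actSet w R)
actSet-∷ i w []       = refl
actSet-∷ i w (r ∷ rs) =
  cong₂ _∷_ (sym (absR-s-absR (i ↑ˡ 2) (isRoot⇒∈roots (act-isRoot w r)))) (actSet-∷ i w rs)

x0-isRoot : All IsRoot x0
x0-isRoot = All.map (proj₁ ∘ ∈positiveRoots⇒Pos) (from-yes (all? (_∈? positiveRoots) x0))

Entry : Set
Entry = Word × List Vec8

word : Entry → Word
word = proj₁

triple : Entry → List Vec8
triple = proj₂

_≈ₑ_ : Rel Entry 0ℓ
e ≈ₑ e' = SameSet (triple e) (triple e')

_≈ₑ?_ : Binary.Decidable _≈ₑ_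
e ≈ₑ? e' = sameSet? (triple e) (triple e')

applyGenerator : Entry → Fin 6 → Entry
applyGenerator e i = i ∷ word e , List.map (act₁ i) (triple e)

-- Sixteen layers exhaust the orbit; orbit-closed would fail otherwise.
orbit : List Entry
orbit = closure 16 ([] , x0)
  where open BreadthFirst _≈ₑ?_ (λ e → List.map (applyGenerator e) (allFin 6))

Listed : List Entry → List Vec8 → Set
Listed L S = Any (λ e → SameSet (triple e) S) L

listed? : ∀ L S → Dec (Listed L S)
listed? L S = any? (λ e → sameSet? (triple e) S) L

InOrbit : List Vec8 → Set
InOrbit = Listed orbit

Covered : List Entry → Entry → Set
Covered L e = Any (λ e' → e ≈ₑ e' × length (word e') ≤ length (word e)) L

covered? : ∀ L e → Dec (Covered L e)
covered? L e = any? (λ e' → (e ≈ₑ? e') ×-dec (length (word e') ℕ.≤? length (word e))) L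

-- The checks that quantify over the orbit inside a loop take it as an argument L: the normaliser
-- shares an argument, but would recompute the breadth-first search at every mention of orbit.
orbit-closed : All (λ e → ∀ i → Covered orbit (applyGenerator e i)) orbit
orbit-closed = from-yes (closed? orbit)
  where
  closed? : ∀ L → Dec (All (λ e → ∀ i → Covered L (applyGenerator e i)) L)
  closed? L = all? (λ e → Fin.all? λ i → covered? L (applyGenerator e i)) L

orbit-minimal : All (λ e → All (λ e' → e ≈ₑ e' → length (word e) ≤ length (word e')) orbit) orbit
orbit-minimal = from-yes (minimal? orbit)
  where
  minimal? : ∀ L → Dec (All (λ e → All (λ e' → e ≈ₑ e' → length (word e) ≤ length (word e')) L) L)
  minimal? L = all? (λ e → all? (λ e' → (e ≈ₑ? e') →-dec (length (word e) ℕ.≤? length (word e'))) L) L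

orbit-actSet : All (λ e → actSet (word e) x0 ≡ triple e) orbit
orbit-actSet = from-yes (all? (λ e → List.≡-dec _≟ᵥ_ (actSet (word e) x0) (triple e)) orbit)

actSet-covered : ∀ w → Covered orbit (w , actSet w x0)
actSet-covered []      = from-yes (covered? orbit ([] , actSet [] x0))
actSet-covered (i ∷ w) = extend (find (actSet-covered w))
  where
  extend : ∃ (λ e → e ∈ orbit × (w , actSet w x0) ≈ₑ e × length (word e) ≤ length w) →
           Covered orbit (i ∷ w , actSet (i ∷ w) x0)
  extend (e , e∈ , w≈e , |e|≤|w|) =
    let (e' , e'∈ , ie≈e' , |e'|≤) = find (All.lookup orbit-closed e∈ i) in
    lose e'∈ (subst (λ X → SameSet X (triple e')) (sym (actSet-∷ i w x0-isRoot))
                    (sameSet-trans (sameSet-map (act₁ i) w≈e) ie≈e') ,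
              ≤-trans |e'|≤ (s≤s |e|≤|w|))

Reach⇒InOrbit : ∀ {S k} → Reach S k → InOrbit S
Reach⇒InOrbit (w , _ , w≈S) =
  let (e , e∈ , w≈e , _) = find (actSet-covered w) in lose e∈ (sameSet-trans (sameSet-sym w≈e) w≈S)

FCoeff-inOrbit : ∀ {S e} → e ∈ orbit → SameSet (triple e) S → FCoeff S (sgn (length (word e)))
FCoeff-inOrbit {S} {e} e∈ T≈S = inj₁ (length (word e) , reach , shortest , refl)
  where
  reach : Reach S (length (word e))
  reach = word e , refl , subst (λ X → SameSet X S) (sym (All.lookup orbit-actSet e∈)) T≈S
  shortest : ∀ j → j < length (word e) → ¬ Reach S j
  shortest j j< (w , refl , w≈S) =
    let (e' , e'∈ , w≈e' , |e'|≤|w|) = find (actSet-covered w)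
        T≈e' = sameSet-trans T≈S (sameSet-trans (sameSet-sym w≈S) w≈e')
    in <⇒≱ j< (≤-trans (All.lookup (All.lookup orbit-minimal e∈) e'∈ T≈e') |e'|≤|w|)

-- Orthogonal subsets of U'

Orthogonal : Vec8 → Vec8 → Set
Orthogonal a b = B a b ≡ + 0

orthogonal? : ∀ a b → Dec (Orthogonal a b)
orthogonal? a b = B a b ℤ.≟ + 0

orthogonalTo : Vec8 → List Vec8
orthogonalTo a = filter (orthogonal? a) U'-roots

TriplesThrough : List Entry → Vec8 → List Vec8 → Set
TriplesThrough L a N = All (λ b → All (λ c → Orthogonal b c → Listed L (a ∷ b ∷ c ∷ [])) N) N

triplesThrough? : ∀ L a N → Dec (TriplesThrough L a N)
triplesThrough? L a N = all? (λ b → all? (λ c → orthogonal? b c →-dec listed? L (a ∷ b ∷ c ∷ [])) N) N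

orthogonalNeighbours-inOrbit : All (λ a → TriplesThrough orbit a (orthogonalTo a)) U'-roots
orthogonalNeighbours-inOrbit = from-yes (triples? orbit)
  where
  triples? : ∀ L → Dec (All (λ a → TriplesThrough L a (orthogonalTo a)) U'-roots)
  triples? L = all? (λ a → triplesThrough? L a (orthogonalTo a)) U'-roots

-- All ordered pairs are listed because B is not known to be symmetric here.
OrthogonalTriple : List Vec8 → Set
OrthogonalTriple T = Unique T × length T ≡ 3 × All (λ x → All (λ y → x ≡ y ⊎ Orthogonal x y) T) T

orbit-orthogonal : All (OrthogonalTriple ∘ triple) orbit
orbit-orthogonal = from-yes (all? (λ e → orthogonalTriple? (triple e)) orbit)
  where
  orthogonalTriple? : ∀ T → Dec (OrthogonalTriple T)
  orthogonalTriple? T =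
    unique? T ×-dec (length T ℕ.≟ 3) ×-dec all? (λ x → all? (λ y → (x ≟ᵥ y) ⊎-dec orthogonal? x y) T) T

orbit-maximal : All (λ e → All (λ d → ¬ All (λ t → Orthogonal t d) (triple e)) U'-roots) orbit
orbit-maximal = from-yes (all? (λ e → maximal? (triple e)) orbit)
  where
  maximal? : ∀ T → Dec (All (λ d → ¬ All (λ t → Orthogonal t d) T) U'-roots)
  maximal? T = all? (λ d → ¬? (all? (λ t → orthogonal? t d) T)) U'-roots

orbit-sign : All (λ e → sgn (length (word e)) ≡ sgn (rho (triple e))) orbit
orbit-sign = from-yes (all? (λ e → sgn (length (word e)) ℤ.≟ sgn (rho (triple e))) orbit)

orthogonalTriple-inOrbit : ∀ {a b c} → U' a → U' b → U' c →
                           Orthogonal a b → Orthogonal a c → Orthogonal b c → InOrbit (a ∷ b ∷ c ∷ [])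
orthogonalTriple-inOrbit {a} ua ub uc ab ac bc =
  All.lookup (All.lookup (All.lookup orthogonalNeighbours-inOrbit (U'⇒∈U'-roots ua)) (neighbour ub ab))
             (neighbour uc ac) bc
  where
  neighbour : ∀ {x} → U' x → Orthogonal a x → x ∈ orthogonalTo a
  neighbour ux ax = ∈-filter⁺ (orthogonal? a) (U'⇒∈U'-roots ux) ax

no-orthogonalQuadruple : ∀ {a b c d} → U' a → U' b → U' c → U' d →
                         Orthogonal a b → Orthogonal a c → Orthogonal a d →
                         Orthogonal b c → Orthogonal b d → Orthogonal c d → ⊥
no-orthogonalQuadruple ua ub uc ud ab ac ad bc bd cd =
  let (e , e∈ , T≈abc) = find (orthogonalTriple-inOrbit ua ub uc ab ac bc) in
  All.lookup (All.lookup orbit-maximal e∈) (U'⇒∈U'-roots ud)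
             (All-sameSet (sameSet-sym T≈abc) (ad ∷ bd ∷ cd ∷ []))

OrthSub-length≤3 : ∀ {R} → OrthSub R → length R ≤ 3
OrthSub-length≤3 {[]}                _ = z≤n
OrthSub-length≤3 {_ ∷ []}            _ = s≤s z≤n
OrthSub-length≤3 {_ ∷ _ ∷ []}        _ = s≤s (s≤s z≤n)
OrthSub-length≤3 {_ ∷ _ ∷ _ ∷ []}    _ = s≤s (s≤s (s≤s z≤n))
OrthSub-length≤3 {_ ∷ _ ∷ _ ∷ _ ∷ _}
  (_ , ua ∷ ub ∷ uc ∷ ud ∷ _ , (ab ∷ ac ∷ ad ∷ _) ∷ (bc ∷ bd ∷ _) ∷ (cd ∷ _) ∷ _) =
  ⊥-elim (no-orthogonalQuadruple ua ub uc ud ab ac ad bc bd cd)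

x0-OrthSub : OrthSub x0
x0-OrthSub = from-yes (unique? x0) ,
             All.map ∈U'-roots⇒U' (from-yes (all? (_∈? U'-roots) x0)) ,
             (refl ∷ refl ∷ []) ∷ (refl ∷ []) ∷ [] ∷ []

Ω⇒InOrbit : ∀ {S} → Ω S → InOrbit S
Ω⇒InOrbit ((uS , aS , orthogonalS) , maximum) =
  triple-inOrbit aS orthogonalS (maximum x0 x0-OrthSub) (OrthSub-length≤3 (uS , aS , orthogonalS))
  where
  triple-inOrbit : ∀ {S} → All U' S → AllPairs Orthogonal S → 3 ≤ length S → length S ≤ 3 → InOrbit S
  triple-inOrbit {_ ∷ _ ∷ _ ∷ []} (ua ∷ ub ∷ uc ∷ []) ((ab ∷ ac ∷ []) ∷ (bc ∷ []) ∷ [] ∷ []) _ _ =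
    orthogonalTriple-inOrbit ua ub uc ab ac bc
  triple-inOrbit {_ ∷ _ ∷ _ ∷ _ ∷ _} _ _ _ (s≤s (s≤s (s≤s ())))
  triple-inOrbit {[]}                _ _ () _
  triple-inOrbit {_ ∷ []}            _ _ (s≤s ()) _
  triple-inOrbit {_ ∷ _ ∷ []}        _ _ (s≤s (s≤s ())) _

Ω-inOrbit : ∀ {S e} → Unique S → All U' S → e ∈ orbit → SameSet (triple e) S → Ω S
Ω-inOrbit {S} {e} uS aS e∈ T≈S = fromTriple (All.lookup orbit-orthogonal e∈)
  where
  fromTriple : OrthogonalTriple (triple e) → Ω S
  fromTriple (uT , |T|≡3 , orthogonalT) =
    (uS , aS , orthogonalS) , λ R o → ≤-trans (OrthSub-length≤3 o) (≤-reflexive 3≡|S|)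
    where
    3≡|S| : 3 ≡ length S
    3≡|S| = trans (sym |T|≡3) (sameSet-length uT uS T≈S)
    orthogonalS : AllPairs Orthogonal S
    orthogonalS = allPairs-fromMembers uS λ x∈ y∈ x≢y →
      Sum.[ ⊥-elim ∘ x≢y , (λ o → o) ]′
        (All.lookup (All.lookup orthogonalT (proj₂ (T≈S _) x∈)) (proj₂ (T≈S _) y∈))

PfCoeff-inOrbit : ∀ {S e} → Unique S → All U' S → e ∈ orbit → SameSet (triple e) S →
                  PfCoeff S (sgn (length (word e)))
PfCoeff-inOrbit {e = e} uS aS e∈ T≈S =
  inj₁ (Ω-inOrbit uS aS e∈ T≈S , rho (triple e) ,
        Rho-sameSet T≈S (Rho-rho (triple e)) , All.lookup orbit-sign e∈)

coefficients : ∀ S → Unique S → All U' S → Dec (InOrbit S) → Σ ℤ (λ c → PfCoeff S c × FCoeff S c)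
coefficients S uS aS (yes S∈) =
  let (e , e∈ , T≈S) = find S∈ in
  sgn (length (word e)) , PfCoeff-inOrbit uS aS e∈ T≈S , FCoeff-inOrbit e∈ T≈S
coefficients S uS aS (no S∉) =
  + 0 , inj₂ (S∉ ∘ Ω⇒InOrbit , refl) , inj₂ ((λ (_ , reach) → S∉ (Reach⇒InOrbit reach)) , refl)

theorem5p19 : (S : List Vec8) → Unique S → All U' S →
    Σ ℤ (λ c → PfCoeff S c × FCoeff S c)
theorem5p19 S uS aS = coefficients S uS aS (listed? orbit S)
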